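{- Let $6 \le p \le q$ and let $D$ be a strong orientation of $K(3,p,q)$ with diameter two, with parts $V_1=\{x_1,x_2,x_3\}$, $V_2$ ($|V_2|=p$), $V_3$ ($|V_3|=q$). If exactly six of the eight sets $V_2^A$ ($A \subseteq \{1,2,3\}$) are nonempty, then $q \le \binom{p-2}{\lfloor \frac{p-2}{2} \rfloor}$.
   Context: $K(3,p,q)$ is the complete tripartite graph with parts $V_1=\{x_1,x_2,x_3\}$, $V_2$ of size $p$, $V_3$ of size $q$. A strong orientation is an orientation of all edges making the digraph strongly connected; its diameter is the maximum directed distance between ordered pairs of vertices. Write $u\to v$ if the edge $uv$ is oriented from $u$ to $v$. For $A \subseteq [3]=\{1,2,3\}$, let $N_D^A$ be the set of vertices $w$ such that $x_i \to w$ for all $i \in A$ and $w \to x_j$ for all $j \in [3]\setminus A$, and $V_2^A = V_2 \cap N_D^A$. The eight sets $V_2^A$ partition $V_2$. -}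

module Defs where

open import Data.Nat using (ℕ; zero; suc)
open import Data.Fin using (Fin)
open import Data.Bool using (Bool; true; false)
import Data.Bool.Properties as BoolP
open import Data.Vec using (Vec; []; _∷_; lookup; tabulate)
open import Data.Vec.Properties using (≡-dec)
open import Data.List using (List; []; _∷_; length; filter)
open import Data.Product using (Σ; ∃; _×_; _,_)
open import Data.Sum using (_⊎_)
open import Data.Fin.Properties using (any?)
open import Relation.Nullary using (¬_)
open import Data.Empty using (⊥)
open import Relation.Binary.PropositionalEquality using (_≡_; _≢_)

data Vertex (p q : ℕ) : Set where
  v₁ : Fin 3 → Vertex p q
  v₂ : Fin p → Vertex p q
  v₃ : Fin q → Vertex p q

-- For the edge between
-- u and v the Bool is true iff it is oriented u → v, with u in the
-- lower-indexed part.
record Orientation (p q : ℕ) : Set where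
  field
    o12 : Fin 3 → Fin p → Bool
    o13 : Fin 3 → Fin q → Bool
    o23 : Fin p → Fin q → Bool
open Orientation public

Arc : ∀ {p q} → Orientation p q → Vertex p q → Vertex p q → Set
Arc D (v₁ i) (v₂ w) = o12 D i w ≡ true
Arc D (v₂ w) (v₁ i) = o12 D i w ≡ false
Arc D (v₁ i) (v₃ z) = o13 D i z ≡ true
Arc D (v₃ z) (v₁ i) = o13 D i z ≡ false
Arc D (v₂ w) (v₃ z) = o23 D w z ≡ true
Arc D (v₃ z) (v₂ w) = o23 D w z ≡ false
Arc D _ _ = ⊥

Dist≤1 : ∀ {p q} → Orientation p q → Vertex p q → Vertex p q → Set
Dist≤1 D u v = u ≡ v ⊎ Arc D u v

Dist≤2 : ∀ {p q} → Orientation p q → Vertex p q → Vertex p q → Set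
Dist≤2 D u v = Dist≤1 D u v ⊎ (∃ λ w → Arc D u w × Arc D w v)

-- D is strong with diameter (exactly) two: every ordered pair is at
-- directed distance ≤ 2 (hence D is strongly connected), and some
-- ordered pair is at distance exactly 2.
Diameter2 : ∀ {p q} → Orientation p q → Set
Diameter2 {p} {q} D =
  (∀ u v → Dist≤2 D u v) × (∃ λ u → ∃ λ v → ¬ Dist≤1 D u v)

-- Subsets A ⊆ {1,2,3} as characteristic vectors (index i ↦ x_{i+1}).
Subset3 : Set
Subset3 = Vec Bool 3

-- The pattern of w ∈ V₂: component i is true iff x_i → w
-- (false iff w → x_i).  Then w ∈ V₂^A iff pattern w ≡ A.
pattern₂ : ∀ {p q} → Orientation p q → Fin p → Subset3
pattern₂ D w = tabulate (λ i → o12 D i w)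

allSubsets3 : List Subset3
allSubsets3 =
  (false ∷ false ∷ false ∷ []) ∷ (false ∷ false ∷ true ∷ []) ∷
  (false ∷ true ∷ false ∷ []) ∷ (false ∷ true ∷ true ∷ []) ∷
  (true ∷ false ∷ false ∷ []) ∷ (true ∷ false ∷ true ∷ []) ∷
  (true ∷ true ∷ false ∷ []) ∷ (true ∷ true ∷ true ∷ []) ∷ []

numNonemptyV₂ : ∀ {p q} → Orientation p q → ℕ
numNonemptyV₂ {p} D =
  length (filter (λ A → any? {n = p} (λ w → ≡-dec BoolP._≟_ (pattern₂ D w) A)) allSubsets3)

-- For z ∈ V₃ let P(z) be the set of i with xᵢ → z, the analogue of the pattern of a vertex
-- of V₂. No w ∈ V₂ has pattern P(z): whichever way wz is oriented, the path of length two
-- back would have to pass through some xᵢ, and that needs xᵢ to lie in exactly one of the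
-- two patterns. Hence every P(z) is one of the two patterns absent from V₂. As each xᵢ has
-- both an in- and an out-neighbour in V₃, those two patterns are complementary, M and ∁M;
-- as q ≥ 3 some z ≠ z' share a pattern, and such twins are joined by a path z → w → z',
-- which rules out M ∈ {∅, [3]}. So V₂ has a vertex u of pattern ∅ and a vertex v of
-- pattern [3]. Let S(z) be the set of w ∈ V₂ with z → w whose pattern is incomparable with
-- P(z). The middle vertex of z → w → z' separates twins, and no subset of a 3-set is
-- incomparable with both M and ∁M, so the S(z) form an antichain of subsets of V₂ ∖ {u, v}
-- and Sperner's theorem, proved via the LYM inequality, gives q ≤ C(p − 2, ⌊(p − 2)/2⌋).

{-# OPTIONS --safe #-}
module Submission where

open import Defs
open import Data.Nat using (ℕ; _≤_; _∸_; _/_)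
open import Data.Nat.Combinatorics using (_C_)
open import Relation.Binary.PropositionalEquality using (_≡_)

open import Data.Bool using (Bool; true; false; not; if_then_else_)
import Data.Bool.Properties as Bool
open import Data.Empty using (⊥-elim)
open import Data.Fin as Fin using (Fin; zero; suc; punchOut)
open import Data.Fin.Properties using (any?)
open import Data.Fin.Subset
open import Data.Fin.Subset.Properties
  using (_∈?_; _⊆?_; anySubset?; nonempty?; Empty-unique; ⊥⊆; ⊆⊤; ⊆-reflexive; x∈∁p⇒x∉p; ∣p∣≤n)
open import Data.List as List using (List; []; _∷_; length; filter)
open import Data.List.Membership.Propositional using () renaming (_∈_ to _∈ˡ_)
open import Data.List.Properties using (length-filter; length-tabulate)
open import Data.List.Relation.Binary.Sublist.Propositional using () renaming (⊆-refl to sublist-refl)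
import Data.List.Relation.Binary.Sublist.Propositional.Properties as Sublist
open import Data.List.Relation.Unary.All as All using (All; []; _∷_)
open import Data.List.Relation.Unary.AllPairs using (AllPairs; []; _∷_)
open import Data.List.Relation.Unary.AllPairs.Properties using (tabulate⁺)
import Data.List.Relation.Unary.Any as Any
open import Data.List.Relation.Unary.Any using (here; there)
open import Data.Nat using (zero; suc; _+_; _*_; _<_; z≤n; s≤s; _≤?_; _!; NonZero; ⌊_/2⌋; ⌈_/2⌉)
open import Data.Nat.Combinatorics using (nCk≡n!/k![n-k]!; k![n∸k]!∣n!)
open import Data.Nat.DivMod using (m/n*n≡m; m/n≡1+[m∸n]/n)
open import Data.Nat.Divisibility using (∣⇒≤)
open import Data.Nat.ListAction using (sum)
open import Data.Nat.Properties
open import Data.Nat.Tactic.RingSolver using (solve-∀)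
open import Algebra.Properties.CommutativeMonoid.Sum +-0-commutativeMonoid
  using (sum-cong-≗; ∑-distrib-+; sum-replicate-zero; sum-syntax)
open import Algebra.Properties.CommutativeSemigroup *-commutativeSemigroup using (x∙yz≈y∙xz)
import Data.Product as Product
open import Data.Product using (∃; ∃₂; _×_; _,_; proj₁; proj₂)
open import Data.Sum using (_⊎_; inj₁; inj₂; [_,_]′)
open import Data.Unit using (tt)

open import Data.Vec using (Vec; []; _∷_; head; lookup; tabulate; insertAt; removeAt; here; there)
open import Data.Vec.Properties
  using (≡-dec; lookup∘tabulate; []=⇒lookup; lookup⇒[]=; insertAt-lookup; removeAt-insertAt;
         removeAt-punchOut; tabulate-cong; tabulate-∘)
open import Function using (_∘_; const)
open import Relation.Binary.Definitions using (DecidableEquality)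
open import Relation.Binary.PropositionalEquality
open import Relation.Nullary using (Dec; yes; no; does; ¬_; ¬?; _×-dec_; _→-dec_; contradiction)
open import Relation.Nullary.Decidable using (dec-true; dec-false; decidable-stable; toWitness; map′; from-no)
open import Relation.Unary using (Pred; Decidable)
open import Relation.Unary.Properties using (_∪?_)

private variable
  n : ℕ

Incomparable : Subset n → Subset n → Set
Incomparable p q = p ⊈ q × q ⊈ p

incomparable? : ∀ (p q : Subset n) → Dec (Incomparable p q)
incomparable? p q = ¬? (p ⊆? q) ×-dec ¬? (q ⊆? p)

⊈⇒Nonempty : ∀ {p q : Subset n} → p ⊈ q → Nonempty p
⊈⇒Nonempty {p = p} p⊈q =
  decidable-stable (nonempty? p) (λ p-empty → p⊈q (subst (_⊆ _) (sym (Empty-unique p-empty)) ⊥⊆))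

_≟ₛ_ : DecidableEquality (Subset n)
_≟ₛ_ = ≡-dec Bool._≟_

allSubset? : ∀ {ℓ} {P : Pred (Subset n) ℓ} → Decidable P → Dec (∀ p → P p)
allSubset? P? = map′ (λ ¬∃¬ p → decidable-stable (P? p) (λ ¬Pp → ¬∃¬ (p , ¬Pp)))
                     (λ ∀P (p , ¬Pp) → ¬Pp (∀P p))
                     (¬? (anySubset? (¬? ∘ P?)))

∁-involutive : ∀ (p : Subset n) → ∁ (∁ p) ≡ p
∁-involutive [] = refl
∁-involutive (x ∷ p) = cong₂ _∷_ (Bool.not-involutive x) (∁-involutive p)

p≢∁p : ∀ (p : Subset (suc n)) → p ≢ ∁ p
p≢∁p (x ∷ _) p≡∁p = Bool.not-¬ refl (cong head p≡∁p)

∁≡⇒≡∁ : ∀ {p r : Subset n} → ∁ p ≡ r → p ≡ ∁ r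
∁≡⇒≡∁ {p = p} ∁p≡r = trans (sym (∁-involutive p)) (cong ∁ ∁p≡r)

insertAt-injective : ∀ {a} {A : Set a} {xs ys : Vec A n} i v → insertAt xs i v ≡ insertAt ys i v → xs ≡ ys
insertAt-injective {xs = xs} {ys} i v eq =
  trans (sym (removeAt-insertAt xs i v)) (trans (cong (λ zs → removeAt zs i) eq) (removeAt-insertAt ys i v))

∈-tabulate⁺ : ∀ (f : Fin n → Bool) {i} → f i ≡ true → i ∈ tabulate f
∈-tabulate⁺ f {i} fi≡true = lookup⇒[]= i _ (trans (lookup∘tabulate f i) fi≡true)

∈-tabulate⁻ : ∀ (f : Fin n → Bool) {i} → i ∈ tabulate f → f i ≡ true
∈-tabulate⁻ f {i} i∈f = trans (sym (lookup∘tabulate f i)) ([]=⇒lookup i∈f)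

∈-removeAt⁺ : ∀ {e x} {p : Subset (suc n)} (e≢x : e ≢ x) → x ∈ p → punchOut e≢x ∈ removeAt p e
∈-removeAt⁺ {p = p} e≢x x∈p = lookup⇒[]= _ _ (trans (removeAt-punchOut p e≢x) ([]=⇒lookup x∈p))

∈-removeAt⁻ : ∀ {e x} {p : Subset (suc n)} (e≢x : e ≢ x) → punchOut e≢x ∈ removeAt p e → x ∈ p
∈-removeAt⁻ {p = p} e≢x x∈p∖e = lookup⇒[]= _ _ (trans (sym (removeAt-punchOut p e≢x)) ([]=⇒lookup x∈p∖e))

removeAt-⊈ : ∀ {e} {p q : Subset (suc n)} → (e ∈ p → e ∈ q) → p ⊈ q → removeAt p e ⊈ removeAt q e
removeAt-⊈ {e = e} {p} {q} e∈p⇒e∈q p⊈q p∖e⊆q∖e = p⊈q p⊆q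
  where
  p⊆q : p ⊆ q
  p⊆q {x} x∈p with e Fin.≟ x
  ... | yes refl = e∈p⇒e∈q x∈p
  ... | no e≢x = ∈-removeAt⁻ e≢x (p∖e⊆q∖e (∈-removeAt⁺ e≢x x∈p))

removeAt-incomparable : ∀ {e} {p q : Subset (suc n)} → e ∈ p → e ∈ q →
  Incomparable p q → Incomparable (removeAt p e) (removeAt q e)
removeAt-incomparable e∈p e∈q (p⊈q , q⊈p) = removeAt-⊈ (const e∈q) p⊈q , removeAt-⊈ (const e∈p) q⊈p

∈⇒∣p∣≡1+∣removeAt∣ : ∀ {e} (p : Subset (suc n)) → e ∈ p → ∣ p ∣ ≡ suc ∣ removeAt p e ∣
∈⇒∣p∣≡1+∣removeAt∣ (true ∷ p) here = refl
∈⇒∣p∣≡1+∣removeAt∣ (true ∷ p@(_ ∷ _)) (there e∈p) = cong suc (∈⇒∣p∣≡1+∣removeAt∣ p e∈p)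
∈⇒∣p∣≡1+∣removeAt∣ (false ∷ p@(_ ∷ _)) (there e∈p) = ∈⇒∣p∣≡1+∣removeAt∣ p e∈p

-- Sperner's theorem via the LYM inequality

Antichain : List (Subset n) → Set
Antichain = AllPairs Incomparable

∑-mono-≤ : ∀ {f g : Fin n → ℕ} → (∀ i → f i ≤ g i) → ∑[ i < n ] f i ≤ ∑[ i < n ] g i
∑-mono-≤ {zero} _ = z≤n
∑-mono-≤ {suc n} f≤g = +-mono-≤ (f≤g zero) (∑-mono-≤ (f≤g ∘ suc))

∑-const : ∀ n c → ∑[ _ < n ] c ≡ n * c
∑-const zero c = refl
∑-const (suc n) c = cong (c +_) (∑-const n c)

∑-indicator : ∀ (p : Subset n) c → ∑[ e < n ] (if does (e ∈? p) then c else 0) ≡ ∣ p ∣ * c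
∑-indicator [] c = refl
∑-indicator (true ∷ p) c = cong (c +_) (∑-indicator p c)
∑-indicator (false ∷ p) c = ∑-indicator p c

-- weight p = n! / C(n, ∣p∣), so lym is the LYM inequality ∑ 1 / C(n, ∣p∣) ≤ 1.
weight : Subset n → ℕ
weight {n} p = ∣ p ∣ ! * (n ∸ ∣ p ∣) !

weight≤! : ∀ (p : Subset n) → weight p ≤ n !
weight≤! {n} p = ∣⇒≤ {{n !≢0}} (k![n∸k]!∣n! (∣p∣≤n p))

linkWeight : Subset (suc n) → Fin (suc n) → ℕ
linkWeight p e = if does (e ∈? p) then weight (removeAt p e) else 0

∑-linkWeight : ∀ (p : Subset (suc n)) → Nonempty p → ∑[ e < suc n ] linkWeight p e ≡ weight p
∑-linkWeight {n} p (x , x∈p) = begin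
  ∑[ e < suc n ] linkWeight p e
    ≡⟨ sum-cong-≗ removeAt-weight ⟩
  ∑[ e < suc n ] (if does (e ∈? p) then k ! * (n ∸ k) ! else 0)
    ≡⟨ ∑-indicator p _ ⟩
  ∣ p ∣ * (k ! * (n ∸ k) !)
    ≡⟨ cong (_* (k ! * (n ∸ k) !)) ∣p∣≡1+k ⟩
  suc k * (k ! * (n ∸ k) !)
    ≡⟨ *-assoc (suc k) (k !) _ ⟨
  suc k ! * (suc n ∸ suc k) !
    ≡⟨ cong (λ m → m ! * (suc n ∸ m) !) ∣p∣≡1+k ⟨
  weight p ∎
  where
  open ≡-Reasoning
  k = ∣ removeAt p x ∣
  ∣p∣≡1+k = ∈⇒∣p∣≡1+∣removeAt∣ p x∈p
  removeAt-weight : ∀ e → linkWeight p e ≡ (if does (e ∈? p) then k ! * (n ∸ k) ! else 0)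
  removeAt-weight e with e ∈? p
  ... | no _ = refl
  ... | yes e∈p = cong (λ m → m ! * (n ∸ m) !)
                       (suc-injective (trans (sym (∈⇒∣p∣≡1+∣removeAt∣ p e∈p)) ∣p∣≡1+k))

link : Fin (suc n) → List (Subset (suc n)) → List (Subset n)
link e [] = []
link e (p ∷ ps) with e ∈? p
... | yes _ = removeAt p e ∷ link e ps
... | no _ = link e ps

totalWeight : List (Subset n) → ℕ
totalWeight ps = sum (List.map weight ps)

totalWeight-link : ∀ e (p : Subset (suc n)) ps →
  totalWeight (link e (p ∷ ps)) ≡ linkWeight p e + totalWeight (link e ps)
totalWeight-link e p ps with e ∈? p
... | yes _ = refl
... | no _ = refl

∑-totalWeight-link : ∀ (ps : List (Subset (suc n))) → All Nonempty ps →
  ∑[ e < suc n ] totalWeight (link e ps) ≡ totalWeight ps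
∑-totalWeight-link {n} [] [] = sum-replicate-zero (suc n)
∑-totalWeight-link {n} (p ∷ ps) (p≢∅ ∷ ps≢∅) = begin
  ∑[ e < suc n ] totalWeight (link e (p ∷ ps))
    ≡⟨ sum-cong-≗ (λ e → totalWeight-link e p ps) ⟩
  ∑[ e < suc n ] (linkWeight p e + totalWeight (link e ps))
    ≡⟨ ∑-distrib-+ (linkWeight p) (λ e → totalWeight (link e ps)) ⟩
  ∑[ e < suc n ] linkWeight p e + ∑[ e < suc n ] totalWeight (link e ps)
    ≡⟨ cong₂ _+_ (∑-linkWeight p p≢∅) (∑-totalWeight-link ps ps≢∅) ⟩
  weight p + totalWeight ps ∎
  where open ≡-Reasoning

link-incomparable : ∀ e {p : Subset (suc n)} ps → e ∈ p →
  All (Incomparable p) ps → All (Incomparable (removeAt p e)) (link e ps)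
link-incomparable e [] e∈p [] = []
link-incomparable e (q ∷ ps) e∈p (p∥q ∷ p∥ps) with e ∈? q
... | yes e∈q = removeAt-incomparable e∈p e∈q p∥q ∷ link-incomparable e ps e∈p p∥ps
... | no _ = link-incomparable e ps e∈p p∥ps

link-antichain : ∀ e (ps : List (Subset (suc n))) → Antichain ps → Antichain (link e ps)
link-antichain e [] [] = []
link-antichain e (p ∷ ps) (p∥ps ∷ ps-antichain) with e ∈? p
... | yes e∈p = link-incomparable e ps e∈p p∥ps ∷ link-antichain e ps ps-antichain
... | no _ = link-antichain e ps ps-antichain

lym : ∀ (ps : List (Subset n)) → Antichain ps → totalWeight ps ≤ n !
lym [] _ = z≤n
lym {n} (p ∷ []) _ = subst (_≤ n !) (sym (+-identityʳ (weight p))) (weight≤! p)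
lym {zero} (_ ∷ _ ∷ _) (((p⊈q , _) ∷ _) ∷ _) = contradiction (λ ()) p⊈q
lym {suc n} ps@(_ ∷ _ ∷ _) ps-antichain@(p∥rest ∷ _) = begin
  totalWeight ps                         ≡⟨ ∑-totalWeight-link ps nonempty ⟨
  ∑[ e < suc n ] totalWeight (link e ps) ≤⟨ ∑-mono-≤ {g = λ _ → n !} link-lym ⟩
  ∑[ e < suc n ] (n !)                   ≡⟨ ∑-const (suc n) (n !) ⟩
  suc n ! ∎
  where
  open ≤-Reasoning
  nonempty : All Nonempty ps
  nonempty = ⊈⇒Nonempty (proj₁ (All.head p∥rest)) ∷ All.map (⊈⇒Nonempty ∘ proj₂) p∥rest
  link-lym : ∀ e → totalWeight (link e ps) ≤ n !
  link-lym e = lym (link e ps) (link-antichain e ps ps-antichain)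

!*!-exchange : ∀ {a b} → a ≤ b → suc a ! * b ! ≤ a ! * suc b !
!*!-exchange {a} {b} a≤b = begin
  suc a ! * b !         ≡⟨ *-assoc (suc a) (a !) (b !) ⟩
  suc a * (a ! * b !)   ≤⟨ *-monoˡ-≤ (a ! * b !) (s≤s a≤b) ⟩
  suc b * (a ! * b !)   ≡⟨ x∙yz≈y∙xz (suc b) (a !) (b !) ⟩
  a ! * suc b ! ∎
  where open ≤-Reasoning

centralWeight : ℕ → ℕ
centralWeight n = ⌊ n /2⌋ ! * (n ∸ ⌊ n /2⌋) !

centralWeight≢0 : ∀ n → NonZero (centralWeight n)
centralWeight≢0 n = ⌊ n /2⌋ !* (n ∸ ⌊ n /2⌋) !≢0

centralWeight-at : ∀ {a b} → ⌊ a + b /2⌋ ≡ a → centralWeight (a + b) ≡ a ! * b !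
centralWeight-at {a} {b} half≡a rewrite half≡a = cong (λ m → a ! * m !) (m+n∸m≡n a b)

centralWeight-≤-spread : ∀ a d → centralWeight (a + (a + d)) ≤ a ! * (a + d) !
centralWeight-≤-spread a zero = ≤-reflexive (centralWeight-at (begin
  ⌊ a + (a + 0) /2⌋ ≡⟨ cong (λ m → ⌊ a + m /2⌋) (+-identityʳ a) ⟩
  ⌊ a + a /2⌋       ≡⟨ n≡⌊n+n/2⌋ a ⟨
  a ∎))
  where open ≡-Reasoning
centralWeight-≤-spread a (suc zero) = ≤-reflexive (centralWeight-at (begin
  ⌊ a + (a + 1) /2⌋ ≡⟨ cong ⌊_/2⌋ (trans (cong (a +_) (+-comm a 1)) (+-suc a a)) ⟩
  ⌈ a + a /2⌉       ≡⟨ n≡⌈n+n/2⌉ a ⟨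
  a ∎))
  where open ≡-Reasoning
centralWeight-≤-spread a (suc (suc d)) = begin
  centralWeight (a + (a + suc (suc d))) ≡⟨ cong centralWeight (shift a d) ⟩
  centralWeight (suc a + (suc a + d))   ≤⟨ centralWeight-≤-spread (suc a) d ⟩
  suc a ! * (suc a + d) !               ≤⟨ !*!-exchange (≤-trans (n≤1+n a) (m≤m+n (suc a) d)) ⟩
  a ! * suc (suc a + d) !               ≡⟨ cong (λ m → a ! * m !) (shift′ a d) ⟨
  a ! * (a + suc (suc d)) ! ∎
  where
  open ≤-Reasoning
  shift : ∀ a d → a + (a + suc (suc d)) ≡ suc a + (suc a + d)
  shift = solve-∀
  shift′ : ∀ a d → a + suc (suc d) ≡ suc (suc a + d)
  shift′ = solve-∀

centralWeight-≤ : ∀ a b → centralWeight (a + b) ≤ a ! * b !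
centralWeight-≤ a b with ≤-total a b
... | inj₁ a≤b with d , refl ← m≤n⇒∃[o]m+o≡n a≤b = centralWeight-≤-spread a d
... | inj₂ b≤a with d , refl ← m≤n⇒∃[o]m+o≡n b≤a =
  subst₂ _≤_ (cong centralWeight (+-comm b (b + d))) (*-comm (b !) ((b + d) !)) (centralWeight-≤-spread b d)

centralWeight≤weight : ∀ (p : Subset n) → centralWeight n ≤ weight p
centralWeight≤weight {n} p =
  subst (λ m → centralWeight m ≤ weight p) (m+[n∸m]≡n (∣p∣≤n p)) (centralWeight-≤ ∣ p ∣ (n ∸ ∣ p ∣))

n!≡nC⌊n/2⌋*centralWeight : ∀ n → n ! ≡ (n C ⌊ n /2⌋) * centralWeight n
n!≡nC⌊n/2⌋*centralWeight n = sym (begin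
  (n C ⌊ n /2⌋) * centralWeight n
    ≡⟨ cong (_* centralWeight n) (nCk≡n!/k![n-k]! (⌊n/2⌋≤n n)) ⟩
  (n ! / centralWeight n) {{centralWeight≢0 n}} * centralWeight n
    ≡⟨ m/n*n≡m {{centralWeight≢0 n}} (k![n∸k]!∣n! (⌊n/2⌋≤n n)) ⟩
  n ! ∎)
  where open ≡-Reasoning

⌊n/2⌋≡n/2 : ∀ n → ⌊ n /2⌋ ≡ n / 2
⌊n/2⌋≡n/2 zero = refl
⌊n/2⌋≡n/2 (suc zero) = refl
⌊n/2⌋≡n/2 (suc (suc n)) =
  trans (cong suc (⌊n/2⌋≡n/2 n)) (sym (m/n≡1+[m∸n]/n {suc (suc n)} {2} (s≤s (s≤s z≤n))))

sperner : ∀ (ps : List (Subset n)) → Antichain ps → length ps ≤ n C (n / 2)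
sperner {n} ps ps-antichain = subst (λ k → length ps ≤ n C k) (⌊n/2⌋≡n/2 n)
  (*-cancelʳ-≤ (length ps) (n C ⌊ n /2⌋) (centralWeight n) {{centralWeight≢0 n}} (begin
    length ps * centralWeight n   ≤⟨ length*central≤totalWeight ps ⟩
    totalWeight ps                ≤⟨ lym ps ps-antichain ⟩
    n !                           ≡⟨ n!≡nC⌊n/2⌋*centralWeight n ⟩
    (n C ⌊ n /2⌋) * centralWeight n ∎))
  where
  open ≤-Reasoning
  length*central≤totalWeight : ∀ (ps : List (Subset n)) → length ps * centralWeight n ≤ totalWeight ps
  length*central≤totalWeight [] = z≤n
  length*central≤totalWeight (p ∷ ps) = +-mono-≤ (centralWeight≤weight p) (length*central≤totalWeight ps)

sperner-avoiding-pair : ∀ {m q} (F : Fin q → Subset (suc (suc m))) {u v} → u ≢ v →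
  (∀ z → u ∉ F z) → (∀ z → v ∉ F z) → (∀ {z z'} → z ≢ z' → F z ⊈ F z') → q ≤ m C (m / 2)
sperner-avoiding-pair {m} {q} F {u} {v} u≢v u∉F v∉F F-⊈ =
  subst (_≤ m C (m / 2)) (length-tabulate G) (sperner (List.tabulate G) (tabulate⁺ G-incomparable))
  where
  v' = punchOut u≢v
  G : Fin q → Subset m
  G z = removeAt (removeAt (F z) u) v'
  v'∉ : ∀ z → v' ∉ removeAt (F z) u
  v'∉ z = v∉F z ∘ ∈-removeAt⁻ u≢v
  G-⊈ : ∀ {z z'} → z ≢ z' → G z ⊈ G z'
  G-⊈ {z} {z'} z≢z' = removeAt-⊈ (⊥-elim ∘ v'∉ z) (removeAt-⊈ (⊥-elim ∘ u∉F z) (F-⊈ z≢z'))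
  G-incomparable : ∀ {z z'} → z ≢ z' → Incomparable (G z) (G z')
  G-incomparable z≢z' = G-⊈ z≢z' , G-⊈ (z≢z' ∘ sym)

module _ {a ℓ₁ ℓ₂} {A : Set a} {P : Pred A ℓ₁} {Q : Pred A ℓ₂} (P? : Decidable P) (Q? : Decidable Q)
         (P⇒Q : ∀ {x} → P x → Q x) where

  filter-mono-≤ : ∀ xs → length (filter P? xs) ≤ length (filter Q? xs)
  filter-mono-≤ xs = Sublist.length-mono-≤ (Sublist.filter⁺ P? Q? (λ { refl → P⇒Q }) (sublist-refl {x = xs}))

  filter-mono-< : ∀ {x xs} → x ∈ˡ xs → ¬ P x → Q x → length (filter P? xs) < length (filter Q? xs)
  filter-mono-< {xs = y ∷ xs} (here refl) ¬Py Qy with P? y | Q? y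
  ... | yes Py | _      = contradiction Py ¬Py
  ... | no _   | no ¬Qy = contradiction Qy ¬Qy
  ... | no _   | yes _  = s≤s (filter-mono-≤ xs)
  filter-mono-< {xs = y ∷ xs} (there x∈xs) ¬Px Qx with P? y | Q? y
  ... | yes _  | yes _  = s≤s (filter-mono-< x∈xs ¬Px Qx)
  ... | yes Py | no ¬Qy = contradiction (P⇒Q Py) ¬Qy
  ... | no _   | yes _  = m<n⇒m<1+n (filter-mono-< x∈xs ¬Px Qx)
  ... | no _   | no _   = filter-mono-< x∈xs ¬Px Qx

module _ {a ℓ} {A : Set a} (_≟_ : DecidableEquality A) {P : Pred A ℓ} (P? : Decidable P) where

  three-rejected : ∀ {x y z xs} → x ∈ˡ xs → y ∈ˡ xs → z ∈ˡ xs → x ≢ y → x ≢ z → y ≢ z →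
    ¬ P x → ¬ P y → ¬ P z → 3 + length (filter P? xs) ≤ length xs
  three-rejected {x} {y} {z} {xs} x∈ y∈ z∈ x≢y x≢z y≢z ¬Px ¬Py ¬Pz = begin
    3 + length (filter P? xs)   ≤⟨ s≤s (s≤s (filter-mono-< P? Px? inj₁ x∈ ¬Px (inj₂ refl))) ⟩
    2 + length (filter Px? xs)  ≤⟨ s≤s (filter-mono-< Px? Pxy? inj₁ y∈ [ ¬Py , x≢y ]′ (inj₂ refl)) ⟩
    1 + length (filter Pxy? xs) ≤⟨ filter-mono-< Pxy? Pxyz? inj₁ z∈ [ [ ¬Pz , x≢z ]′ , y≢z ]′ (inj₂ refl) ⟩
    length (filter Pxyz? xs)    ≤⟨ length-filter Pxyz? xs ⟩
    length xs ∎
    where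
    open ≤-Reasoning
    Px? = P? ∪? (x ≟_)
    Pxy? = Px? ∪? (y ≟_)
    Pxyz? = Pxy? ∪? (z ≟_)

∈-allSubsets3 : ∀ A → A ∈ˡ allSubsets3
∈-allSubsets3 = toWitness {a? = allSubset? λ A → Any.any? (A ≟ₛ_) allSubsets3} tt

incomparable-∁ : ∀ (p q : Subset 3) → Incomparable p q → ¬ Incomparable p (∁ q)
incomparable-∁ = toWitness {a? = allSubset? λ p → allSubset? λ q →
  incomparable? p q →-dec ¬? (incomparable? p (∁ q))} tt

separating-pattern : ∀ (q : Subset 3) → q ≢ ⊥ → q ≢ ⊤ →
  ∃₂ λ p i → i ∈ q × i ∉ p × Incomparable p q × p ≢ ∁ q
separating-pattern = toWitness {a? = allSubset? λ q → ¬? (q ≟ₛ ⊥) →-dec ¬? (q ≟ₛ ⊤) →-dec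
  anySubset? λ p → any? λ i → i ∈? q ×-dec ¬? (i ∈? p) ×-dec incomparable? p q ×-dec ¬? (p ≟ₛ ∁ q)} tt

-- Orientations of K(3,p,q) of diameter two

true≢false : true ≢ false
true≢false ()

module _ {p q} (D : Orientation p q) where

  pattern₃ : Fin q → Subset 3
  pattern₃ z = tabulate (λ i → o13 D i z)

  Occurs : Subset 3 → Set
  Occurs A = ∃ λ w → pattern₂ D w ≡ A

  occurs? : ∀ A → Dec (Occurs A)
  occurs? A = any? λ w → pattern₂ D w ≟ₛ A

  Separates : Fin q → Fin p → Set
  Separates z w = Arc D (v₃ z) (v₂ w) × Incomparable (pattern₂ D w) (pattern₃ z)

  separates? : ∀ z w → Dec (Separates z w)
  separates? z w = (o23 D w z Bool.≟ false) ×-dec incomparable? (pattern₂ D w) (pattern₃ z)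

  separated : Fin q → Subset p
  separated z = tabulate (does ∘ separates? z)

  ∈-pattern₂⁺ : ∀ {i w} → o12 D i w ≡ true → i ∈ pattern₂ D w
  ∈-pattern₂⁺ {w = w} = ∈-tabulate⁺ (λ j → o12 D j w)

  ∈-pattern₂⁻ : ∀ {i w} → i ∈ pattern₂ D w → o12 D i w ≡ true
  ∈-pattern₂⁻ {w = w} = ∈-tabulate⁻ (λ j → o12 D j w)

  ∈-pattern₃⁺ : ∀ {i z} → o13 D i z ≡ true → i ∈ pattern₃ z
  ∈-pattern₃⁺ {z = z} = ∈-tabulate⁺ (λ j → o13 D j z)

  ∈-pattern₃⁻ : ∀ {i z} → i ∈ pattern₃ z → o13 D i z ≡ true
  ∈-pattern₃⁻ {z = z} = ∈-tabulate⁻ (λ j → o13 D j z)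

  Arc-asym : ∀ {u v} → Arc D u v → ¬ Arc D v u
  Arc-asym {v₁ _} {v₁ _} ()
  Arc-asym {v₁ _} {v₂ _} u→v v→u = true≢false (trans (sym u→v) v→u)
  Arc-asym {v₁ _} {v₃ _} u→v v→u = true≢false (trans (sym u→v) v→u)
  Arc-asym {v₂ _} {v₁ _} u→v v→u = true≢false (trans (sym v→u) u→v)
  Arc-asym {v₂ _} {v₂ _} ()
  Arc-asym {v₂ _} {v₃ _} u→v v→u = true≢false (trans (sym u→v) v→u)
  Arc-asym {v₃ _} {v₁ _} u→v v→u = true≢false (trans (sym v→u) u→v)
  Arc-asym {v₃ _} {v₂ _} u→v v→u = true≢false (trans (sym v→u) u→v)
  Arc-asym {v₃ _} {v₃ _} ()

  arc₂₃⊎arc₃₂ : ∀ w z → Arc D (v₂ w) (v₃ z) ⊎ Arc D (v₃ z) (v₂ w)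
  arc₂₃⊎arc₃₂ w z with o23 D w z
  ... | true = inj₁ refl
  ... | false = inj₂ refl

  two-step : ∀ {u v} → Dist≤2 D u v → u ≢ v → ¬ Arc D u v → ∃ λ w → Arc D u w × Arc D w v
  two-step (inj₁ (inj₁ u≡v)) u≢v _ = contradiction u≡v u≢v
  two-step (inj₁ (inj₂ u→v)) _ ¬u→v = contradiction u→v ¬u→v
  two-step (inj₂ path) _ _ = path

  o13-coordinate : ∀ {z z'} → pattern₃ z ≡ pattern₃ z' → ∀ i → o13 D i z ≡ o13 D i z'
  o13-coordinate {z} {z'} eq i = begin
    o13 D i z              ≡⟨ lookup∘tabulate (λ j → o13 D j z) i ⟨
    lookup (pattern₃ z) i  ≡⟨ cong (λ A → lookup A i) eq ⟩
    lookup (pattern₃ z') i ≡⟨ lookup∘tabulate (λ j → o13 D j z') i ⟩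
    o13 D i z' ∎
    where open ≡-Reasoning

  ¬Separates-⊥ : ∀ {w z} → pattern₂ D w ≡ ⊥ → ¬ Separates z w
  ¬Separates-⊥ {z = z} w≡⊥ (_ , w⊈z , _) = w⊈z (subst (_⊆ pattern₃ z) (sym w≡⊥) ⊥⊆)

  ¬Separates-⊤ : ∀ {w z} → pattern₂ D w ≡ ⊤ → ¬ Separates z w
  ¬Separates-⊤ {z = z} w≡⊤ (_ , _ , z⊈w) = z⊈w (subst (pattern₃ z ⊆_) (sym w≡⊤) ⊆⊤)

  ∈-separated : ∀ {w z} → Separates z w → w ∈ separated z
  ∈-separated {w} {z} s = ∈-tabulate⁺ (does ∘ separates? z) (dec-true (separates? z w) s)

  ∉-separated : ∀ {w z} → ¬ Separates z w → w ∉ separated z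
  ∉-separated {w} {z} ¬s w∈ =
    true≢false (trans (sym (∈-tabulate⁻ (does ∘ separates? z) w∈)) (dec-false (separates? z w) ¬s))

  module _ (diam : ∀ u v → Dist≤2 D u v) where

    pattern₂⊆pattern₃⇒¬arc₂₃ : ∀ {w z} → pattern₂ D w ⊆ pattern₃ z → ¬ Arc D (v₂ w) (v₃ z)
    pattern₂⊆pattern₃⇒¬arc₂₃ {w} {z} w⊆z w→z
      with two-step (diam (v₃ z) (v₂ w)) (λ ()) (Arc-asym {v₂ w} {v₃ z} w→z)
    ... | v₁ i , z→xᵢ , xᵢ→w = true≢false (trans (sym (∈-pattern₃⁻ (w⊆z (∈-pattern₂⁺ xᵢ→w)))) z→xᵢ)
    ... | v₂ _ , _ , ()
    ... | v₃ _ , () , _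

    pattern₃⊆pattern₂⇒¬arc₃₂ : ∀ {w z} → pattern₃ z ⊆ pattern₂ D w → ¬ Arc D (v₃ z) (v₂ w)
    pattern₃⊆pattern₂⇒¬arc₃₂ {w} {z} z⊆w z→w
      with two-step (diam (v₂ w) (v₃ z)) (λ ()) (Arc-asym {v₃ z} {v₂ w} z→w)
    ... | v₁ i , w→xᵢ , xᵢ→z = true≢false (trans (sym (∈-pattern₂⁻ (z⊆w (∈-pattern₃⁺ xᵢ→z)))) w→xᵢ)
    ... | v₂ _ , () , _
    ... | v₃ _ , _ , ()

    pattern₃-absent : ∀ z → ¬ Occurs (pattern₃ z)
    pattern₃-absent z (w , w≡z) with arc₂₃⊎arc₃₂ w z
    ... | inj₁ w→z = pattern₂⊆pattern₃⇒¬arc₂₃ (⊆-reflexive w≡z) w→z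
    ... | inj₂ z→w = pattern₃⊆pattern₂⇒¬arc₃₂ (⊆-reflexive (sym w≡z)) z→w

    path₁₃₂ : ∀ {i w} → Arc D (v₂ w) (v₁ i) → ∃ λ z → Arc D (v₁ i) (v₃ z) × Arc D (v₃ z) (v₂ w)
    path₁₃₂ {i} {w} w→xᵢ with two-step (diam (v₁ i) (v₂ w)) (λ ()) (Arc-asym {v₂ w} {v₁ i} w→xᵢ)
    ... | v₁ _ , () , _
    ... | v₂ _ , _ , ()
    ... | v₃ z , xᵢ→z , z→w = z , xᵢ→z , z→w

    path₂₃₁ : ∀ {i w} → Arc D (v₁ i) (v₂ w) → ∃ λ z → Arc D (v₂ w) (v₃ z) × Arc D (v₃ z) (v₁ i)
    path₂₃₁ {i} {w} xᵢ→w with two-step (diam (v₂ w) (v₁ i)) (λ ()) (Arc-asym {v₁ i} {v₂ w} xᵢ→w)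
    ... | v₁ _ , _ , ()
    ... | v₂ _ , () , _
    ... | v₃ z , w→z , z→xᵢ = z , w→z , z→xᵢ

    twin-path : ∀ {z z'} → z ≢ z' → pattern₃ z ≡ pattern₃ z' →
      ∃ λ w → Arc D (v₃ z) (v₂ w) × Arc D (v₂ w) (v₃ z')
    twin-path {z} {z'} z≢z' z≡z' with two-step (diam (v₃ z) (v₃ z')) (λ { refl → z≢z' refl }) (λ ())
    ... | v₁ i , z→xᵢ , xᵢ→z' =
      ⊥-elim (true≢false (trans (sym xᵢ→z') (trans (sym (o13-coordinate z≡z' i)) z→xᵢ)))
    ... | v₂ w , z→w , w→z' = w , z→w , w→z'
    ... | v₃ _ , () , _

    twin-separator : ∀ {z z'} → z ≢ z' → pattern₃ z ≡ pattern₃ z' →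
      ∃ λ w → Separates z w × ¬ Separates z' w
    twin-separator {z} {z'} z≢z' z≡z' with twin-path z≢z' z≡z'
    ... | w , z→w , w→z' = w , (z→w , w⊈z , z⊈w) , Arc-asym {v₂ w} {v₃ z'} w→z' ∘ proj₁
      where
      w⊈z : pattern₂ D w ⊈ pattern₃ z
      w⊈z w⊆z = pattern₂⊆pattern₃⇒¬arc₂₃ (subst (pattern₂ D w ⊆_) z≡z' w⊆z) w→z'
      z⊈w : pattern₃ z ⊈ pattern₂ D w
      z⊈w z⊆w = pattern₃⊆pattern₂⇒¬arc₃₂ z⊆w z→w

    twin-pattern-proper : ∀ {z z'} → z ≢ z' → pattern₃ z ≡ pattern₃ z' →
      pattern₃ z ≢ ⊥ × pattern₃ z ≢ ⊤
    twin-pattern-proper z≢z' z≡z' with twin-path z≢z' z≡z'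
    ... | w , z→w , w→z' =
      (λ z≡⊥ → pattern₃⊆pattern₂⇒¬arc₃₂ (subst (_⊆ pattern₂ D w) (sym z≡⊥) ⊥⊆) z→w) ,
      (λ z≡⊤ → pattern₂⊆pattern₃⇒¬arc₂₃ (subst (pattern₂ D w ⊆_) (trans (sym z≡⊤) z≡z') ⊆⊤) w→z')

    module _ (six : numNonemptyV₂ D ≡ 6) where

      occurs-unless : ∀ {X Y Z} → ¬ Occurs X → ¬ Occurs Y → X ≢ Y → Z ≢ X → Z ≢ Y → Occurs Z
      occurs-unless {X} {Y} {Z} ¬X ¬Y X≢Y Z≢X Z≢Y = decidable-stable (occurs? Z) λ ¬Z →
        from-no (9 ≤? 8) (subst (λ k → 3 + k ≤ 8) six
          (three-rejected _≟ₛ_ occurs? (∈-allSubsets3 X) (∈-allSubsets3 Y) (∈-allSubsets3 Z)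
                          X≢Y (Z≢X ∘ sym) (Z≢Y ∘ sym) ¬X ¬Y ¬Z))

      only-two-absent : ∀ {X Y Z} → ¬ Occurs X → ¬ Occurs Y → X ≢ Y → ¬ Occurs Z → Z ≢ X → Z ≡ Y
      only-two-absent ¬X ¬Y X≢Y ¬Z Z≢X = decidable-stable (_ ≟ₛ _) (¬Z ∘ occurs-unless ¬X ¬Y X≢Y Z≢X)

      occurs-among-three : ∀ {ℓ} (R : Pred (Subset 3) ℓ) {X Y Z} → R X → R Y → R Z →
        X ≢ Y → X ≢ Z → Y ≢ Z → ∃ λ w → R (pattern₂ D w)
      occurs-among-three R {X} {Y} RX RY RZ X≢Y X≢Z Y≢Z with occurs? X | occurs? Y
      ... | yes (w , w≡X) | _ = w , subst R (sym w≡X) RX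
      ... | no _ | yes (w , w≡Y) = w , subst R (sym w≡Y) RY
      ... | no ¬X | no ¬Y =
        let w , w≡Z = occurs-unless ¬X ¬Y X≢Y (X≢Z ∘ sym) (Y≢Z ∘ sym) in w , subst R (sym w≡Z) RZ

      o12-attains : ∀ i b → ∃ λ w → o12 D i w ≡ b
      o12-attains i b = Product.map₂ (λ {w} → trans (sym (lookup∘tabulate (λ j → o12 D j w) i)))
        (occurs-among-three (λ A → lookup A i ≡ b)
          {with-bit (false ∷ false ∷ [])} {with-bit (false ∷ true ∷ [])} {with-bit (true ∷ false ∷ [])}
          (insertAt-lookup _ i b) (insertAt-lookup _ i b) (insertAt-lookup _ i b)
          (distinct (λ ())) (distinct (λ ())) (distinct (λ ())))
        where
        with-bit : Vec Bool 2 → Subset 3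
        with-bit xs = insertAt xs i b
        distinct : ∀ {xs ys} → xs ≢ ys → with-bit xs ≢ with-bit ys
        distinct xs≢ys = xs≢ys ∘ insertAt-injective i b

      o13-attains : ∀ i b → ∃ λ z → o13 D i z ≡ b
      o13-attains i true = Product.map₂ proj₁ (path₁₃₂ (proj₂ (o12-attains i false)))
      o13-attains i false = Product.map₂ proj₂ (path₂₃₁ (proj₂ (o12-attains i true)))

      pattern₃-≢ : ∀ {i z z'} → o13 D i z' ≡ not (o13 D i z) → pattern₃ z' ≢ pattern₃ z
      pattern₃-≢ {i} flipped z'≡z = Bool.not-¬ (o13-coordinate z'≡z i) flipped

      pattern₃-dichotomy : ∀ z z' → pattern₃ z' ≡ pattern₃ z ⊎ pattern₃ z' ≡ ∁ (pattern₃ z)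
      pattern₃-dichotomy z z' with pattern₃ z' ≟ₛ pattern₃ z
      ... | yes z'≡z = inj₁ z'≡z
      ... | no z'≢z = inj₂ (trans (tabulate-cong complementary) (tabulate-∘ not (λ i → o13 D i z)))
        where
        complementary : ∀ i → o13 D i z' ≡ not (o13 D i z)
        complementary i with o13-attains i (not (o13 D i z))
        ... | z'' , flipped = trans (o13-coordinate z'≡z'' i) flipped
          where
          z'≡z'' : pattern₃ z' ≡ pattern₃ z''
          z'≡z'' = sym (only-two-absent (pattern₃-absent z) (pattern₃-absent z') (z'≢z ∘ sym)
                                        (pattern₃-absent z'') (pattern₃-≢ flipped))

      ∁-pattern₃-absent : ∀ z → ¬ Occurs (∁ (pattern₃ z))
      ∁-pattern₃-absent z with o13-attains zero (not (o13 D zero z))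
      ... | z' , flipped with pattern₃-dichotomy z z'
      ...   | inj₁ z'≡z = contradiction z'≡z (pattern₃-≢ flipped)
      ...   | inj₂ z'≡∁z = subst (¬_ ∘ Occurs) z'≡∁z (pattern₃-absent z')

      occurs-unless-pattern₃ : ∀ z {A} → A ≢ pattern₃ z → A ≢ ∁ (pattern₃ z) → Occurs A
      occurs-unless-pattern₃ z =
        occurs-unless (pattern₃-absent z) (∁-pattern₃-absent z) (p≢∁p (pattern₃ z))

      twins-exist : ∀ {z₀ z₁ z₂} → z₀ ≢ z₁ → z₀ ≢ z₂ → z₁ ≢ z₂ →
        ∃₂ λ z z' → z ≢ z' × pattern₃ z ≡ pattern₃ z'
      twins-exist {z₀} {z₁} {z₂} z₀≢z₁ z₀≢z₂ z₁≢z₂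
        with pattern₃-dichotomy z₀ z₁ | pattern₃-dichotomy z₀ z₂
      ... | inj₁ z₁≡z₀ | _ = z₀ , z₁ , z₀≢z₁ , sym z₁≡z₀
      ... | inj₂ _ | inj₁ z₂≡z₀ = z₀ , z₂ , z₀≢z₂ , sym z₂≡z₀
      ... | inj₂ z₁≡∁z₀ | inj₂ z₂≡∁z₀ = z₁ , z₂ , z₁≢z₂ , trans z₁≡∁z₀ (sym z₂≡∁z₀)

      module Separation {t t'} (t≢t' : t ≢ t') (t≡t' : pattern₃ t ≡ pattern₃ t') where

        t≢⊥ : pattern₃ t ≢ ⊥
        t≢⊥ = proj₁ (twin-pattern-proper t≢t' t≡t')

        t≢⊤ : pattern₃ t ≢ ⊤
        t≢⊤ = proj₂ (twin-pattern-proper t≢t' t≡t')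

        pattern₃-proper : ∀ z → pattern₃ z ≢ ⊥ × pattern₃ z ≢ ⊤
        pattern₃-proper z with pattern₃-dichotomy t z
        ... | inj₁ z≡t = t≢⊥ ∘ trans (sym z≡t) , t≢⊤ ∘ trans (sym z≡t)
        ... | inj₂ z≡∁t = t≢⊤ ∘ ∁≡⇒≡∁ ∘ trans (sym z≡∁t) , t≢⊥ ∘ ∁≡⇒≡∁ ∘ trans (sym z≡∁t)

        ⊥-occurs : Occurs ⊥
        ⊥-occurs = occurs-unless-pattern₃ t (t≢⊥ ∘ sym) (t≢⊤ ∘ ∁≡⇒≡∁ ∘ sym)

        ⊤-occurs : Occurs ⊤
        ⊤-occurs = occurs-unless-pattern₃ t (t≢⊤ ∘ sym) (t≢⊥ ∘ ∁≡⇒≡∁ ∘ sym)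

        u v : Fin p
        u = proj₁ ⊥-occurs
        v = proj₁ ⊤-occurs

        u≢v : u ≢ v
        u≢v u≡v =
          contradiction (trans (sym (proj₂ ⊥-occurs)) (trans (cong (pattern₂ D) u≡v) (proj₂ ⊤-occurs))) λ ()

        u∉separated : ∀ z → u ∉ separated z
        u∉separated z = ∉-separated (¬Separates-⊥ (proj₂ ⊥-occurs))

        v∉separated : ∀ z → v ∉ separated z
        v∉separated z = ∉-separated (¬Separates-⊤ (proj₂ ⊤-occurs))

        -- A vertex w of pattern X has a path xᵢ → z' → w; as i ∈ pattern₃ z' ∩ pattern₃ z,
        -- z' has the pattern of z, so w separates z unless z' is a twin of z.
        separator-exists : ∀ z → ∃ (Separates z)
        separator-exists z
          with separating-pattern (pattern₃ z) (proj₁ (pattern₃-proper z)) (proj₂ (pattern₃-proper z))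
        ... | X , i , i∈z , i∉X , X∥z , X≢∁z
          with occurs-unless-pattern₃ z (λ X≡z → proj₁ X∥z (⊆-reflexive X≡z)) X≢∁z
        ... | w , w≡X with path₁₃₂ {i} {w} (Bool.¬-not (i∉X ∘ subst (i ∈_) w≡X ∘ ∈-pattern₂⁺))
        ... | z' , xᵢ→z' , z'→w with pattern₃-dichotomy z z'
        ...   | inj₂ z'≡∁z = contradiction i∈z (x∈∁p⇒x∉p (subst (i ∈_) z'≡∁z (∈-pattern₃⁺ xᵢ→z')))
        ...   | inj₁ z'≡z with z Fin.≟ z'
        ...     | yes refl = w , z'→w , subst (λ A → Incomparable A (pattern₃ z)) (sym w≡X) X∥z
        ...     | no z≢z' = Product.map₂ proj₁ (twin-separator z≢z' (sym z'≡z))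

        separates-exclusively : ∀ {z z'} → z ≢ z' → ∃ λ w → Separates z w × ¬ Separates z' w
        separates-exclusively {z} {z'} z≢z' with pattern₃-dichotomy z z'
        ... | inj₁ z'≡z = twin-separator z≢z' (sym z'≡z)
        ... | inj₂ z'≡∁z =
          let w , z→w , w∥z = separator-exists z in
          w , (z→w , w∥z) , λ (_ , w∥z') →
            incomparable-∁ (pattern₂ D w) (pattern₃ z) w∥z (subst (Incomparable (pattern₂ D w)) z'≡∁z w∥z')

        separated-⊈ : ∀ {z z'} → z ≢ z' → separated z ⊈ separated z'
        separated-⊈ z≢z' z⊆z' =
          let w , s , ¬s' = separates-exclusively z≢z' in ∉-separated ¬s' (z⊆z' (∈-separated s))

theorem4p22 : (p q : ℕ) → 6 ≤ p → p ≤ q → (D : Orientation p q) →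
    Diameter2 D → numNonemptyV₂ D ≡ 6 →
    q ≤ (p ∸ 2) C ((p ∸ 2) / 2)
theorem4p22 (suc (suc (suc p))) (suc (suc (suc q))) (s≤s (s≤s (s≤s _))) (s≤s (s≤s (s≤s _))) D (diam , _) six
  with twins-exist D diam six {zero} {suc zero} {suc (suc zero)} (λ ()) (λ ()) (λ ())
... | _ , _ , t≢t' , t≡t' = sperner-avoiding-pair (separated D) u≢v u∉separated v∉separated separated-⊈
  where open Separation D diam six t≢t' t≡t'
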